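{- Let $K$ be a set of positive integers and $\alpha$ a positive integer. If there exists a $K$-GDD of type $g_1^{u_1}g_2^{u_2}\cdots g_n^{u_n}$, a super-simple $(\alpha g_i+1,4,2)$DD for each $i=1,\dots,n$, and a super-simple $(4,2)$-DGDD of type $\alpha^k$ for each $k\in K$, then there exists a super-simple $(\alpha\sum_{i=1}^n g_iu_i+1,4,2)$DD.
   Context: A $K$-GDD of type $g_1^{u_1}\cdots g_n^{u_n}$ is a triple $(V,\mathcal{G},\mathcal{B})$ where $V$ is partitioned into groups ($u_i$ groups of size $g_i$) and $\mathcal{B}$ is a collection of subsets of $V$ with sizes in $K$ such that every pair of distinct points lies in exactly one block or in one group, but not both. A $(v,4,2)$DD is a pair $(X,\mathcal{B})$ with $|X|=v$ and $\mathcal{B}$ a collection of ordered $4$-tuples of distinct points such that every ordered pair $(x,y)$ of distinct points appears in exactly $2$ blocks ($(x,y)$ appears in $(a_1,\dots,a_4)$ if $x=a_i,y=a_j$, $i<j$). A $(4,2)$-DGDD of type $\alpha^k$ is a point set partitioned into $k$ groups of size $\alpha$ with a collection of ordered $4$-tuples of distinct points such that each ordered pair of points from different groups appears in exactly $2$ blocks and no two points of the same group appear together in a block. Such objects are super-simple if any two blocks, viewed as sets, share at most two points. -}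

module Defs where

open import Data.Nat using (ℕ; zero; suc; _+_; _*_; _≤_)
open import Data.Bool using (Bool; true; false; _∧_; _∨_; if_then_else_)
open import Data.Fin using (Fin)
import Data.Fin.Properties as FinP
open import Data.Product using (Σ; _×_; _,_; proj₁; proj₂)
import Data.Product.Properties as ProdP
open import Data.List using (List; []; _∷_; length; lookup; tabulate)
open import Data.Nat.ListAction using (sum)
open import Data.List.Relation.Unary.Unique.Propositional using (Unique)
open import Data.List.Relation.Unary.All using (All)
open import Data.Vec using (Vec; []; _∷_; toList) renaming (lookup to vlookup)
open import Relation.Binary.PropositionalEquality using (_≡_; _≢_)
open import Relation.Binary.Definitions using (DecidableEquality)
open import Relation.Nullary.Decidable using (⌊_⌋)

count : {B : Set} → (B → Bool) → List B → ℕ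
count p []       = 0
count p (b ∷ bs) = (if p b then 1 else 0) + count p bs

module Points {X : Set} (_≟_ : DecidableEquality X) where

  _==_ : X → X → Bool
  x == y = ⌊ x ≟ y ⌋

  memL : X → List X → Bool
  memL x []       = false
  memL x (y ∷ ys) = (x == y) ∨ memL x ys

  occursOrd : X → X → Vec X 4 → Bool
  occursOrd x y (a ∷ b ∷ c ∷ d ∷ []) =
    ((x == a) ∧ (y == b)) ∨ ((x == a) ∧ (y == c)) ∨ ((x == a) ∧ (y == d)) ∨
    ((x == b) ∧ (y == c)) ∨ ((x == b) ∧ (y == d)) ∨ ((x == c) ∧ (y == d))

  Distinct4 : Vec X 4 → Set
  Distinct4 b = ∀ i j → vlookup b i ≡ vlookup b j → i ≡ j

  -- number of points the two blocks (viewed as sets) have in common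
  -- (blocks have distinct entries, so this is the size of the intersection)
  interSize : Vec X 4 → Vec X 4 → ℕ
  interSize b b' = count (λ x → memL x (toList b')) (toList b)

  SuperSimple : List (Vec X 4) → Set
  SuperSimple bs = ∀ p q → p ≢ q → interSize (lookup bs p) (lookup bs q) ≤ 2

  occCount : X → X → List (Vec X 4) → ℕ
  occCount x y bs = count (occursOrd x y) bs

  pairCount : X → X → List (List X) → ℕ
  pairCount x y bs = count (λ b → memL x b ∧ memL y b) bs

module DDv (v : ℕ) = Points (FinP._≟_ {v})

IsDD : (v : ℕ) → List (Vec (Fin v) 4) → Set
IsDD v bs = All Distinct4 bs × (∀ x y → x ≢ y → occCount x y bs ≡ 2)
  where open DDv v

SuperSimpleDD : ℕ → Set
SuperSimpleDD v = Σ (List (Vec (Fin v) 4)) λ bs → IsDD v bs × SuperSimple bs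
  where open DDv v

-- (4,2)-DGDD of type α^k: points Fin k × Fin α, the group of a point is
-- its first coordinate

DGPoint : ℕ → ℕ → Set
DGPoint α k = Fin k × Fin α

module DGk (α k : ℕ) = Points (ProdP.≡-dec (FinP._≟_ {k}) (FinP._≟_ {α}))

IsDGDD : (α k : ℕ) → List (Vec (DGPoint α k) 4) → Set
IsDGDD α k bs =
  All (λ b → Distinct4 b ×
             (∀ i j → i ≢ j → proj₁ (vlookup b i) ≢ proj₁ (vlookup b j))) bs ×
  (∀ x y → proj₁ x ≢ proj₁ y → occCount x y bs ≡ 2)
  where open DGk α k

SuperSimpleDGDD : ℕ → ℕ → Set
SuperSimpleDGDD α k =
  Σ (List (Vec (DGPoint α k) 4)) λ bs → IsDGDD α k bs × SuperSimple bs
  where open DGk α k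

-- Points are triples (i , t , s) with
-- i : Fin n, t : Fin (u i), s : Fin (g i); the groups are the sets
-- {(i , t , s) | s : Fin (g i)}, i.e. for each i there are u i groups of
-- size g i.  (Any GDD of this type is isomorphic to one on this point set.)

GPoint : (n : ℕ) → (g u : Fin n → ℕ) → Set
GPoint n g u = Σ (Fin n) λ i → Fin (u i) × Fin (g i)

groupOf : {n : ℕ} {g u : Fin n → ℕ} → GPoint n g u → Σ (Fin n) λ i → Fin (u i)
groupOf (i , t , s) = (i , t)

module GP (n : ℕ) (g u : Fin n → ℕ) =
  Points (ProdP.≡-dec (FinP._≟_ {n})
           (λ {i} → ProdP.≡-dec (FinP._≟_ {u i}) (FinP._≟_ {g i})))

IsGDD : (K : ℕ → Set) (n : ℕ) (g u : Fin n → ℕ) → List (List (GPoint n g u)) → Set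
IsGDD K n g u bs =
  All (λ b → Unique b × K (length b)) bs ×
  (∀ x y → x ≢ y →
     (groupOf x ≡ groupOf y → pairCount x y bs ≡ 0) ×
     (groupOf x ≢ groupOf y → pairCount x y bs ≡ 1))
  where open GP n g u

GDD : (K : ℕ → Set) (n : ℕ) (g u : Fin n → ℕ) → Set
GDD K n g u = Σ (List (List (GPoint n g u))) (IsGDD K n g u)

sumGU : (n : ℕ) → (g u : Fin n → ℕ) → ℕ
sumGU n g u = sum (tabulate (λ i → g i * u i))

-- Inflate every point of the GDD α-fold and add a point ∞. Over the copies of each GDD
-- block B lay the given super-simple DGDD of type α^|B|, whose groups are the α copies of a
-- point, and over the copies of each group G together with ∞ lay the given super-simple
-- (α|G|+1,4,2)DD. A pair of copies of points from different groups is covered twice by the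
-- DGDD over the unique block through those points; every other pair lies in exactly one
-- group together with ∞ and is covered twice by that DD alone. Blocks of different
-- ingredients share at most one point: GDD blocks pairwise meet in at most one point and meet
-- each group in at most one point, a DGDD block holds at most one copy of each point, and the
-- copies of distinct groups share only ∞. So super-simplicity is inherited from the ingredients.

module Submission where

open import Defs
open import Data.Bool using (Bool; true; false; _∧_; _∨_; if_then_else_)
open import Data.Empty using (⊥; ⊥-elim)
open import Data.Fin using (Fin; zero; suc)
open import Data.Fin.Patterns using (0F; 1F; 2F; 3F)
open import Data.Fin.Properties using (suc-injective; +↔⊎; *↔×) renaming (_≟_ to _≟F_)
open import Data.List using (List; []; _∷_; _++_; map; concat; tabulate; lookup; length)
open import Data.List.Properties using (map-tabulate; tabulate-cong)
open import Data.List.Membership.Propositional using (_∈_; _∉_)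
open import Data.List.Membership.Propositional.Properties using (∈-map⁻; ∈-lookup)
import Data.List.Membership.DecPropositional as DecMembership
open import Data.List.Relation.Unary.All as All using (All; []; _∷_)
import Data.List.Relation.Unary.All.Properties as All
open import Data.List.Relation.Unary.AllPairs as AllPairs using (AllPairs; []; _∷_)
import Data.List.Relation.Unary.AllPairs.Properties as AllPairs
open import Data.List.Relation.Unary.Any using (here; there; index)
open import Data.List.Relation.Unary.Any.Properties using (lookup-index)
open import Data.List.Relation.Unary.Unique.Propositional using (Unique)
open import Data.Maybe using (Maybe; nothing; just; maybe)
import Data.Maybe as Maybe
open import Data.Maybe.Properties using (just-injective)
import Data.Maybe.Properties as MaybeP
open import Data.Nat using (ℕ; zero; suc; _+_; _*_; _≤_; z≤n; s≤s)
open import Data.Nat.ListAction using (sum)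
open import Data.Nat.Properties
  using (+-comm; *-comm; *-distribˡ-+; +-assoc; +-identityʳ; m≤n+m; ≤-trans; ≤-reflexive)
open import Data.Product using (Σ; ∃; _×_; _,_; proj₁; proj₂)
import Data.Product as Product
open import Data.Product.Algebra using (×-comm)
open import Data.Product.Function.Dependent.Propositional using (Σ-↔)
open import Data.Product.Function.NonDependent.Propositional using (_×-↔_)
open import Data.Product.Properties using (,-injectiveˡ; ,-injectiveʳ)
import Data.Product.Properties as ProdP
open import Data.Sum using (_⊎_; inj₁; inj₂)
open import Data.Sum.Function.Propositional using (_⊎-↔_)
open import Data.Unit using (⊤; tt)
open import Data.Vec using (Vec; []; _∷_; toList) renaming (lookup to vlookup; map to vmap)
open import Data.Vec.Properties using (lookup-map; toList-map)
open import Function using (_∘_; id; _∋_)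
open import Function.Bundles using (_↔_; Inverse; Injection; mk↔ₛ′)
open import Function.Definitions using (Injective)
open import Function.Properties.Inverse using (↔-refl; ↔-sym; ↔-trans; ↔⇒↣)
open import Relation.Binary.Definitions using (DecidableEquality)
open import Relation.Binary.PropositionalEquality
open import Relation.Nullary using (¬_; yes; no)

module _ {B : Set} where

  count-++ : (p : B → Bool) (xs ys : List B) → count p (xs ++ ys) ≡ count p xs + count p ys
  count-++ p []       ys = refl
  count-++ p (x ∷ xs) ys rewrite count-++ p xs ys = sym (+-assoc (if p x then 1 else 0) _ _)

  count-concat : (p : B → Bool) (xss : List (List B)) → count p (concat xss) ≡ sum (map (count p) xss)
  count-concat p []         = refl
  count-concat p (xs ∷ xss) rewrite count-++ p xs (concat xss) | count-concat p xss = refl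

  count-concat-tabulate : ∀ {m} (p : B → Bool) (f : Fin m → List B) →
                          count p (concat (tabulate f)) ≡ sum (tabulate (count p ∘ f))
  count-concat-tabulate p f = trans (count-concat p (tabulate f)) (cong sum (map-tabulate f (count p)))

  count-cong : {p q : B → Bool} → (∀ x → p x ≡ q x) → ∀ xs → count p xs ≡ count q xs
  count-cong p≗q []       = refl
  count-cong p≗q (x ∷ xs) rewrite p≗q x | count-cong p≗q xs = refl

  count-map : {C : Set} (p : B → Bool) (f : C → B) (xs : List C) → count p (map f xs) ≡ count (p ∘ f) xs
  count-map p f []       = refl
  count-map p f (x ∷ xs) rewrite count-map p f xs = refl

  count-none : (p : B → Bool) {xs : List B} → All (λ x → p x ≡ false) xs → count p xs ≡ 0
  count-none p []              = refl
  count-none p (px≡false ∷ ps) rewrite px≡false = count-none p ps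

  count≡0⇒none : (p : B → Bool) (xs : List B) → count p xs ≡ 0 → All (λ x → p x ≡ false) xs
  count≡0⇒none p []       _ = []
  count≡0⇒none p (x ∷ xs) c≡0 with p x in px
  ... | false = px ∷ count≡0⇒none p xs c≡0

  ∈⇒1≤count : (p : B → Bool) {x : B} {xs : List B} → x ∈ xs → p x ≡ true → 1 ≤ count p xs
  ∈⇒1≤count p (here refl) px rewrite px = s≤s z≤n
  ∈⇒1≤count p {xs = y ∷ _} (there x∈) px =
    ≤-trans (∈⇒1≤count p x∈ px) (m≤n+m _ (if p y then 1 else 0))

sum-tabulate-≡0 : ∀ m (h : Fin m → ℕ) → (∀ j → h j ≡ 0) → sum (tabulate h) ≡ 0
sum-tabulate-≡0 zero    h h≡0 = refl
sum-tabulate-≡0 (suc m) h h≡0 rewrite h≡0 zero = sum-tabulate-≡0 m (h ∘ suc) (h≡0 ∘ suc)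

sum-tabulate-single : ∀ m (h : Fin m → ℕ) (i : Fin m) → (∀ j → j ≢ i → h j ≡ 0) →
                      sum (tabulate h) ≡ h i
sum-tabulate-single (suc m) h zero    h≡0
  rewrite sum-tabulate-≡0 m (h ∘ suc) (λ j → h≡0 (suc j) λ ()) = +-identityʳ (h zero)
sum-tabulate-single (suc m) h (suc i) h≡0 rewrite h≡0 zero (λ ()) =
  sum-tabulate-single m (h ∘ suc) i (λ j j≢i → h≡0 (suc j) (j≢i ∘ suc-injective))

module _ {X : Set} (p : X → Bool) where

  count-toList≡0 : ∀ {n} (b : Vec X n) → (∀ i → p (vlookup b i) ≡ false) → count p (toList b) ≡ 0
  count-toList≡0 []      _    = refl
  count-toList≡0 (y ∷ b) none rewrite none zero = count-toList≡0 b (none ∘ suc)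

  count-toList≤1 : ∀ {n} (b : Vec X n) →
                   (∀ i j → p (vlookup b i) ≡ true → p (vlookup b j) ≡ true → i ≡ j) →
                   count p (toList b) ≤ 1
  count-toList≤1 []      _    = z≤n
  count-toList≤1 (y ∷ b) once with p y in py
  ... | false = count-toList≤1 b (λ i j pᵢ pⱼ → suc-injective (once (suc i) (suc j) pᵢ pⱼ))
  ... | true  = s≤s (≤-reflexive (count-toList≡0 b elsewhere))
    where
    elsewhere : ∀ i → p (vlookup b i) ≡ false
    elsewhere i with p (vlookup b i) in pᵢ
    ... | true  with () ← once zero (suc i) py pᵢ
    ... | false = refl

module _ {X : Set} where

  ∈-toList⇒lookup : ∀ {n x} (b : Vec X n) → x ∈ toList b → ∃ λ i → vlookup b i ≡ x
  ∈-toList⇒lookup (y ∷ b) (here refl) = zero , refl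
  ∈-toList⇒lookup (y ∷ b) (there x∈)  = Product.map suc id (∈-toList⇒lookup b x∈)

  ∈-toList-vmap⁻ : ∀ {Y : Set} {n z} {f : X → Y} (b : Vec X n) → z ∈ toList (vmap f b) →
                   ∃ λ x → x ∈ toList b × z ≡ f x
  ∈-toList-vmap⁻ {f = f} b z∈ = ∈-map⁻ f (subst (_ ∈_) (toList-map f b) z∈)

  lookup∈toList : ∀ {n} (b : Vec X n) i → vlookup b i ∈ toList b
  lookup∈toList (y ∷ b) zero    = here refl
  lookup∈toList (y ∷ b) (suc i) = there (lookup∈toList b i)

  Unique⇒lookup-injective : ∀ {xs : List X} → Unique xs → Injective _≡_ _≡_ (lookup xs)
  Unique⇒lookup-injective {_ ∷ _} (_   ∷ _) {zero}  {zero}  _  = refl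
  Unique⇒lookup-injective {_ ∷ _} (x∉ ∷ _) {zero}  {suc j} eq = ⊥-elim (All.lookup x∉ (∈-lookup j) eq)
  Unique⇒lookup-injective {_ ∷ _} (x∉ ∷ _) {suc i} {zero}  eq = ⊥-elim (All.lookup x∉ (∈-lookup i) (sym eq))
  Unique⇒lookup-injective {_ ∷ _} (_  ∷ u) {suc i} {suc j} eq = cong suc (Unique⇒lookup-injective u eq)

  MeetAtMostOnce : List X → List X → Set
  MeetAtMostOnce xs ys = ∀ {x y} → x ∈ xs → x ∈ ys → y ∈ xs → y ∈ ys → x ≡ y

  meetAtMostOnce-sym : ∀ {xs ys} → MeetAtMostOnce xs ys → MeetAtMostOnce ys xs
  meetAtMostOnce-sym m x∈ys x∈xs y∈ys y∈xs = m x∈xs x∈ys y∈xs y∈ys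

∨≡true : ∀ a b → a ∨ b ≡ true → a ≡ true ⊎ b ≡ true
∨≡true true  b _  = inj₁ refl
∨≡true false b eq = inj₂ eq

∧≡true : ∀ a b → a ∧ b ≡ true → a ≡ true × b ≡ true
∧≡true true true _ = refl , refl

module PointsProperties {X : Set} (_≟_ : DecidableEquality X) where
  open Points _≟_

  ==⇒≡ : ∀ {x y} → (x == y) ≡ true → x ≡ y
  ==⇒≡ {x} {y} eq with x ≟ y
  ... | yes x≡y = x≡y

  ==-refl : ∀ x → (x == x) ≡ true
  ==-refl x with x ≟ x
  ... | yes _   = refl
  ... | no x≢x = ⊥-elim (x≢x refl)

  ≢⇒==-false : ∀ {x y} → x ≢ y → (x == y) ≡ false
  ≢⇒==-false {x} {y} x≢y with x ≟ y
  ... | yes x≡y = ⊥-elim (x≢y x≡y)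
  ... | no _    = refl

  memL⇒∈ : ∀ {x} xs → memL x xs ≡ true → x ∈ xs
  memL⇒∈ {x} (y ∷ xs) eq with ∨≡true (x == y) (memL x xs) eq
  ... | inj₁ x==y = here (==⇒≡ x==y)
  ... | inj₂ x∈xs = there (memL⇒∈ xs x∈xs)

  ∈⇒memL : ∀ {x xs} → x ∈ xs → memL x xs ≡ true
  ∈⇒memL {x} (here refl) rewrite ==-refl x = refl
  ∈⇒memL {x} {y ∷ _} (there x∈) rewrite ∈⇒memL x∈ with x == y
  ... | true  = refl
  ... | false = refl

  ∉⇒memL-false : ∀ {x} xs → x ∉ xs → memL x xs ≡ false
  ∉⇒memL-false {x} xs x∉ with memL x xs in eq
  ... | true  = ⊥-elim (x∉ (memL⇒∈ xs eq))
  ... | false = refl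

  private
    positionsOf : ∀ {x y} (b : Vec X 4) i j → i ≢ j → ((x == vlookup b i) ∧ (y == vlookup b j)) ≡ true →
                  ∃ λ i → ∃ λ j → i ≢ j × vlookup b i ≡ x × vlookup b j ≡ y
    positionsOf b i j i≢j hit with ∧≡true _ _ hit
    ... | x==bᵢ , y==bⱼ = i , j , i≢j , sym (==⇒≡ x==bᵢ) , sym (==⇒≡ y==bⱼ)

  occursOrd⇒positions : ∀ {x y} (b : Vec X 4) → occursOrd x y b ≡ true →
    ∃ λ i → ∃ λ j → i ≢ j × vlookup b i ≡ x × vlookup b j ≡ y
  occursOrd⇒positions {x} {y} b@(a₀ ∷ a₁ ∷ a₂ ∷ a₃ ∷ []) occ
    with ∨≡true ((x == a₀) ∧ (y == a₁)) _ occ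
  ... | inj₁ hit = positionsOf b 0F 1F (λ ()) hit
  ... | inj₂ occ with ∨≡true ((x == a₀) ∧ (y == a₂)) _ occ
  ... | inj₁ hit = positionsOf b 0F 2F (λ ()) hit
  ... | inj₂ occ with ∨≡true ((x == a₀) ∧ (y == a₃)) _ occ
  ... | inj₁ hit = positionsOf b 0F 3F (λ ()) hit
  ... | inj₂ occ with ∨≡true ((x == a₁) ∧ (y == a₂)) _ occ
  ... | inj₁ hit = positionsOf b 1F 2F (λ ()) hit
  ... | inj₂ occ with ∨≡true ((x == a₁) ∧ (y == a₃)) _ occ
  ... | inj₁ hit = positionsOf b 1F 3F (λ ()) hit
  ... | inj₂ hit = positionsOf b 2F 3F (λ ()) hit

  interSize≤1 : ∀ b b' → Distinct4 b → MeetAtMostOnce (toList b) (toList b') → interSize b b' ≤ 1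
  interSize≤1 b b' distinct meet = count-toList≤1 (λ x → memL x (toList b')) b
    λ i j inᵢ inⱼ → distinct i j
      (meet (lookup∈toList b i) (memL⇒∈ _ inᵢ) (lookup∈toList b j) (memL⇒∈ _ inⱼ))

  AtMostTwoCommon : Vec X 4 → Vec X 4 → Set
  AtMostTwoCommon b b' = interSize b b' ≤ 2 × interSize b' b ≤ 2

  meetAtMostOnce⇒atMostTwoCommon : ∀ {b b'} → Distinct4 b → Distinct4 b' →
    MeetAtMostOnce (toList b) (toList b') → AtMostTwoCommon b b'
  meetAtMostOnce⇒atMostTwoCommon {b} {b'} d d' meet =
    ≤-trans (interSize≤1 b b' d meet) (s≤s z≤n) ,
    ≤-trans (interSize≤1 b' b d' (meetAtMostOnce-sym meet)) (s≤s z≤n)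

  superSimple⇒allPairs : ∀ bs → SuperSimple bs → AllPairs AtMostTwoCommon bs
  superSimple⇒allPairs []       _  = []
  superSimple⇒allPairs (b ∷ bs) ss =
    All.tabulate (λ b'∈ → let i = index b'∈ in
      subst (AtMostTwoCommon b) (sym (lookup-index b'∈)) (ss 0F (suc i) (λ ()) , ss (suc i) 0F (λ ()))) ∷
    superSimple⇒allPairs bs (λ p q p≢q → ss (suc p) (suc q) (p≢q ∘ suc-injective))

  allPairs⇒superSimple : ∀ bs → AllPairs AtMostTwoCommon bs → SuperSimple bs
  allPairs⇒superSimple (b ∷ bs) (r ∷ rs) zero    zero    0≢0 = ⊥-elim (0≢0 refl)
  allPairs⇒superSimple (b ∷ bs) (r ∷ rs) zero    (suc q) _   = proj₁ (All.lookup r (∈-lookup q))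
  allPairs⇒superSimple (b ∷ bs) (r ∷ rs) (suc p) zero    _   = proj₂ (All.lookup r (∈-lookup p))
  allPairs⇒superSimple (b ∷ bs) (r ∷ rs) (suc p) (suc q) p≢q =
    allPairs⇒superSimple bs rs p q (p≢q ∘ cong suc)

  pairCount≡0⇒apart : ∀ {x y} Bs → pairCount x y Bs ≡ 0 → All (λ B → x ∈ B → y ∉ B) Bs
  pairCount≡0⇒apart {x} {y} Bs none = All.map apart (count≡0⇒none _ Bs none)
    where
    apart : ∀ {B} → (memL x B ∧ memL y B) ≡ false → x ∈ B → y ∉ B
    apart notBoth x∈ y∈ rewrite ∈⇒memL x∈ | ∈⇒memL y∈ with () ← notBoth

  pairCount≤1⇒meetAtMostOnce : ∀ Bs → (∀ x y → x ≢ y → pairCount x y Bs ≤ 1) →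
                                AllPairs MeetAtMostOnce Bs
  pairCount≤1⇒meetAtMostOnce []       _     = []
  pairCount≤1⇒meetAtMostOnce (B ∷ Bs) atMost1 =
    All.tabulate meet ∷
    pairCount≤1⇒meetAtMostOnce Bs (λ x y x≢y → ≤-trans (m≤n+m _ _) (atMost1 x y x≢y))
    where
    meet : ∀ {B'} → B' ∈ Bs → MeetAtMostOnce B B'
    meet B'∈ {x} {y} x∈B x∈B' y∈B y∈B' with x ≟ y
    ... | yes x≡y = x≡y
    ... | no x≢y with atMost1 x y x≢y
    ... | bound rewrite ∈⇒memL x∈B | ∈⇒memL y∈B
      with s≤s () ← ≤-trans (s≤s (∈⇒1≤count _ B'∈ (cong₂ _∧_ (∈⇒memL x∈B') (∈⇒memL y∈B'))))
                            bound

-- Transport along injections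

module Transport {A Y : Set} (_≟A_ : DecidableEquality A) (_≟Y_ : DecidableEquality Y)
                 (f : A → Y) (f-injective : Injective _≡_ _≡_ f) where
  private
    module PA = Points _≟A_
    module PY = Points _≟Y_
    module PPA = PointsProperties _≟A_
    module PPY = PointsProperties _≟Y_

  ==-map : ∀ x y → (f x PY.== f y) ≡ (x PA.== y)
  ==-map x y with x ≟A y
  ... | yes refl = PPY.==-refl (f x)
  ... | no x≢y  = PPY.≢⇒==-false (x≢y ∘ f-injective)

  memL-map : ∀ x xs → PY.memL (f x) (map f xs) ≡ PA.memL x xs
  memL-map x []       = refl
  memL-map x (y ∷ xs) rewrite ==-map x y | memL-map x xs = refl

  occursOrd-map : ∀ x y b → PY.occursOrd (f x) (f y) (vmap f b) ≡ PA.occursOrd x y b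
  occursOrd-map x y (a₀ ∷ a₁ ∷ a₂ ∷ a₃ ∷ [])
    rewrite ==-map x a₀ | ==-map x a₁ | ==-map x a₂ | ==-map y a₁ | ==-map y a₂ | ==-map y a₃ = refl

  interSize-map : ∀ b b' → PY.interSize (vmap f b) (vmap f b') ≡ PA.interSize b b'
  interSize-map b b' rewrite toList-map f b | toList-map f b' =
    trans (count-map _ f (toList b)) (count-cong (λ x → memL-map x (toList b')) (toList b))

  occCount-map : ∀ x y bs → PY.occCount (f x) (f y) (map (vmap f) bs) ≡ PA.occCount x y bs
  occCount-map x y bs = trans (count-map _ (vmap f) bs) (count-cong (occursOrd-map x y) bs)

  occCount-outsideImage : ∀ x y bs → (∀ a a' → f a ≡ x → f a' ≡ y → ⊥) →
                          PY.occCount x y (map (vmap f) bs) ≡ 0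
  occCount-outsideImage x y bs outside =
    trans (count-map _ (vmap f) bs) (count-none _ {bs} (All.tabulate (λ {b} _ → neverOccurs b)))
    where
    neverOccurs : ∀ b → PY.occursOrd x y (vmap f b) ≡ false
    neverOccurs b with PY.occursOrd x y (vmap f b) in occ
    ... | false = refl
    ... | true with i , j , _ , bᵢ≡x , bⱼ≡y ← PPY.occursOrd⇒positions (vmap f b) occ =
      ⊥-elim (outside _ _ (trans (sym (lookup-map i f b)) bᵢ≡x) (trans (sym (lookup-map j f b)) bⱼ≡y))

  distinct4-map : ∀ b → PA.Distinct4 b → PY.Distinct4 (vmap f b)
  distinct4-map b distinct i j eq =
    distinct i j (f-injective (trans (sym (lookup-map i f b)) (trans eq (lookup-map j f b))))

  atMostTwoCommon-map : ∀ {b b'} → PPA.AtMostTwoCommon b b' → PPY.AtMostTwoCommon (vmap f b) (vmap f b')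
  atMostTwoCommon-map {b} {b'} bounds rewrite interSize-map b b' | interSize-map b' b = bounds

  allPairs-map : ∀ {bs} → AllPairs PPA.AtMostTwoCommon bs → AllPairs PPY.AtMostTwoCommon (map (vmap f) bs)
  allPairs-map = AllPairs.map⁺ ∘ AllPairs.map (λ {b} {b'} → atMostTwoCommon-map {b} {b'})

  superSimple-map : ∀ bs → PA.SuperSimple bs → AllPairs PPY.AtMostTwoCommon (map (vmap f) bs)
  superSimple-map bs = allPairs-map ∘ PPA.superSimple⇒allPairs bs

-- Relabelling point sets

Fin-suc↔Maybe : ∀ m → Fin (suc m) ↔ Maybe (Fin m)
Fin-suc↔Maybe m = mk↔ₛ′ (λ { zero → nothing ; (suc i) → just i }) (maybe suc zero)
  (λ { nothing → refl ; (just i) → refl }) (λ { zero → refl ; (suc i) → refl })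

Maybe-↔ : {A B : Set} → A ↔ B → Maybe A ↔ Maybe B
Maybe-↔ A↔B = mk↔ₛ′ (Maybe.map to) (Maybe.map from)
  (λ { nothing → refl ; (just b) → cong just (strictlyInverseˡ b) })
  (λ { nothing → refl ; (just a) → cong just (strictlyInverseʳ a) })
  where open Inverse A↔B

Σ-Fin-suc↔⊎ : ∀ m (F : Fin (suc m) → Set) → Σ (Fin (suc m)) F ↔ (F zero ⊎ Σ (Fin m) (F ∘ suc))
Σ-Fin-suc↔⊎ m F = mk↔ₛ′ (λ { (zero , x) → inj₁ x ; (suc i , x) → inj₂ (i , x) })
  (λ { (inj₁ x) → zero , x ; (inj₂ (i , x)) → suc i , x })
  (λ { (inj₁ x) → refl ; (inj₂ (i , x)) → refl }) (λ { (zero , x) → refl ; (suc i , x) → refl })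

Fin-sum↔Σ : ∀ m (h : Fin m → ℕ) → Fin (sum (tabulate h)) ↔ Σ (Fin m) (Fin ∘ h)
Fin-sum↔Σ zero    h = mk↔ₛ′ (λ ()) (λ { (() , _) }) (λ { (() , _) }) (λ ())
Fin-sum↔Σ (suc m) h = ↔-trans +↔⊎
  (↔-trans (↔-refl ⊎-↔ Fin-sum↔Σ m (h ∘ suc)) (↔-sym (Σ-Fin-suc↔⊎ m (Fin ∘ h))))

inflated↔ : ∀ α N {Q : Set} → Fin N ↔ Q → Fin (α * N + 1) ↔ Maybe (Q × Fin α)
inflated↔ α N Fin↔Q rewrite +-comm (α * N) 1 | *-comm α N =
  ↔-trans (Fin-suc↔Maybe (N * α)) (Maybe-↔ (↔-trans *↔× (Fin↔Q ×-↔ ↔-refl)))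

Fin-sumGU↔GPoint : ∀ n (g u : Fin n → ℕ) → Fin (sumGU n g u) ↔ GPoint n g u
Fin-sumGU↔GPoint n g u =
  ↔-trans (Fin-sum↔Σ n (λ i → g i * u i)) (Σ-↔ ↔-refl (↔-trans *↔× (×-comm _ _)))

module _ {X : Set} (_≟X_ : DecidableEquality X) where
  open Points _≟X_
  open PointsProperties _≟X_

  IsSuperSimpleDD : List (Vec X 4) → Set
  IsSuperSimpleDD bs =
    All Distinct4 bs × (∀ x y → x ≢ y → occCount x y bs ≡ 2) × AllPairs AtMostTwoCommon bs

  superSimpleDD-↔ : ∀ {v} → Fin v ↔ X → ∀ bs → IsSuperSimpleDD bs → SuperSimpleDD v
  superSimpleDD-↔ {v} Fin↔X bs (distinct , twice , simple) =
    map (vmap from) bs ,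
    (All.map⁺ (All.map (λ {b} → distinct4-map b) distinct) , twice′) ,
    PPV.allPairs⇒superSimple _ (allPairs-map simple)
    where
    open Inverse Fin↔X
    module PV = DDv v
    module PPV = PointsProperties (_≟F_ {v})
    open Transport _≟X_ _≟F_ from (Injection.injective (↔⇒↣ (↔-sym Fin↔X)))
    open ≡-Reasoning
    twice′ : ∀ x y → x ≢ y → PV.occCount x y (map (vmap from) bs) ≡ 2
    twice′ x y x≢y = begin
      PV.occCount x y (map (vmap from) bs)
        ≡⟨ cong₂ (λ x y → PV.occCount x y (map (vmap from) bs))
                 (sym (strictlyInverseʳ x)) (sym (strictlyInverseʳ y)) ⟩
      PV.occCount (from (to x)) (from (to y)) (map (vmap from) bs)
        ≡⟨ occCount-map (to x) (to y) bs ⟩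
      occCount (to x) (to y) bs
        ≡⟨ twice (to x) (to y) (x≢y ∘ Injection.injective (↔⇒↣ Fin↔X)) ⟩
      2 ∎

module GroupedPoints {G A : Set} (_≟G_ : DecidableEquality G) (_≟A_ : DecidableEquality A) where
  open Points (ProdP.≡-dec _≟G_ _≟A_)
  open PointsProperties (ProdP.≡-dec _≟G_ _≟A_)

  GroupTransversal : Vec (G × A) 4 → Set
  GroupTransversal b = ∀ i j → i ≢ j → proj₁ (vlookup b i) ≢ proj₁ (vlookup b j)

  groupTransversal-∈ : ∀ {b x y} → GroupTransversal b → x ∈ toList b → y ∈ toList b →
                       proj₁ x ≡ proj₁ y → x ≡ y
  groupTransversal-∈ {b} transversal x∈ y∈ sameGroup
    with i , refl ← ∈-toList⇒lookup b x∈ | j , refl ← ∈-toList⇒lookup b y∈ | i ≟F j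
  ... | yes refl = refl
  ... | no i≢j   = ⊥-elim (transversal i j i≢j sameGroup)

  occCount-sameGroup : ∀ {bs x y} → All GroupTransversal bs → proj₁ x ≡ proj₁ y → occCount x y bs ≡ 0
  occCount-sameGroup {bs} {x} {y} transversals sameGroup =
    count-none _ (All.map (λ {b} → neverOccurs b) transversals)
    where
    neverOccurs : ∀ b → GroupTransversal b → occursOrd x y b ≡ false
    neverOccurs b transversal with occursOrd x y b in occ
    ... | false = refl
    ... | true with i , j , i≢j , refl , refl ← occursOrd⇒positions b occ =
      ⊥-elim (transversal i j i≢j sameGroup)

-- The construction

module Construction
  (K : ℕ → Set) (α n : ℕ) (g u : Fin n → ℕ)
  (gddBlocks : List (List (GPoint n g u))) (isGDD : IsGDD K n g u gddBlocks)
  (dd : ∀ i → SuperSimpleDD (α * g i + 1))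
  (dgdd : ∀ k → K k → SuperSimpleDGDD α k) where

  P : Set
  P = GPoint n g u

  Group : Set
  Group = Σ (Fin n) λ i → Fin (u i)

  _≟P_ : DecidableEquality P
  _≟P_ = ProdP.≡-dec _≟F_ (λ {i} → ProdP.≡-dec (_≟F_ {u i}) (_≟F_ {g i}))

  _≟G_ : DecidableEquality Group
  _≟G_ = ProdP.≡-dec _≟F_ (λ {i} → _≟F_ {u i})

  Point : Set
  Point = Maybe (P × Fin α)

  pattern ∞ = nothing

  _≟_ : DecidableEquality Point
  _≟_ = MaybeP.≡-dec (ProdP.≡-dec _≟P_ _≟F_)

  open Points _≟_
  open PointsProperties _≟_
  private
    module GDD = GP n g u
    module GDDProperties = PointsProperties _≟P_
  open DecMembership _≟P_ using (_∈?_)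

  GoodBlock : List P → Set
  GoodBlock B = Unique B × K (length B)

  goodBlocks : All GoodBlock gddBlocks
  goodBlocks = proj₁ isGDD

  pairCount-sameGroup : ∀ {p q} → p ≢ q → groupOf p ≡ groupOf q → GDD.pairCount p q gddBlocks ≡ 0
  pairCount-sameGroup p≢q = proj₁ (proj₂ isGDD _ _ p≢q)

  pairCount-otherGroup : ∀ {p q} → groupOf p ≢ groupOf q → GDD.pairCount p q gddBlocks ≡ 1
  pairCount-otherGroup {p} {q} other = proj₂ (proj₂ isGDD p q (other ∘ cong groupOf)) other

  Transversal : List P → Set
  Transversal B = ∀ {p q} → p ∈ B → q ∈ B → groupOf p ≡ groupOf q → p ≡ q

  blocks-transversal : All Transversal gddBlocks
  blocks-transversal = All.tabulate transversal
    where
    transversal : ∀ {B} → B ∈ gddBlocks → Transversal B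
    transversal B∈ {p} {q} p∈ q∈ sameGroup with p ≟P q
    ... | yes p≡q = p≡q
    ... | no p≢q  =
      ⊥-elim (All.lookup (GDDProperties.pairCount≡0⇒apart gddBlocks (pairCount-sameGroup p≢q sameGroup))
                         B∈ p∈ q∈)

  blocks-meetAtMostOnce : AllPairs MeetAtMostOnce gddBlocks
  blocks-meetAtMostOnce = GDDProperties.pairCount≤1⇒meetAtMostOnce gddBlocks atMostOnce
    where
    atMostOnce : ∀ p q → p ≢ q → GDD.pairCount p q gddBlocks ≤ 1
    atMostOnce p q p≢q with groupOf p ≟G groupOf q
    ... | yes same = ≤-trans (≤-reflexive (pairCount-sameGroup p≢q same)) z≤n
    ... | no other = ≤-reflexive (pairCount-otherGroup other)

  inflate : (B : List P) → Fin (length B) × Fin α → Point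
  inflate B (j , a) = just (lookup B j , a)

  inflate-injective : ∀ {B} → Unique B → Injective _≡_ _≡_ (inflate B)
  inflate-injective B-unique eq with just-injective eq
  ... | eq′ = cong₂ _,_ (Unique⇒lookup-injective B-unique (,-injectiveˡ eq′)) (,-injectiveʳ eq′)

  inflate-index : ∀ {B p} (p∈ : p ∈ B) a → inflate B (index p∈ , a) ≡ just (p , a)
  inflate-index p∈ a = cong (λ p → just (p , a)) (sym (lookup-index p∈))

  record DgddBlock (B : List P) (b : Vec Point 4) : Set where
    field
      distinct : Distinct4 b
      spread   : ∀ {z} → z ∈ toList b → ∃ λ p → ∃ λ a → z ≡ just (p , a) × p ∈ B
      oneCopy  : ∀ {p a a'} → just (p , a) ∈ toList b → just (p , a') ∈ toList b → a ≡ a'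

  module OverBlock (B : List P) (good : GoodBlock B) where
    private
      open GroupedPoints (_≟F_ {length B}) (_≟F_ {α})
      module DG = DGk α (length B)
      module T = Transport (ProdP.≡-dec _≟F_ _≟F_) _≟_ (inflate B) (inflate-injective (proj₁ good))
      ingredient = dgdd (length B) (proj₂ good)

      ingredientBlocks : List (Vec (DGPoint α (length B)) 4)
      ingredientBlocks = proj₁ ingredient

      ingredientShape : All (λ c → DG.Distinct4 c × GroupTransversal c) ingredientBlocks
      ingredientShape = proj₁ (proj₁ (proj₂ ingredient))

      ingredientTwice : ∀ x y → proj₁ x ≢ proj₁ y → DG.occCount x y ingredientBlocks ≡ 2
      ingredientTwice = proj₂ (proj₁ (proj₂ ingredient))

      open ≡-Reasoning

    copy : List (Vec Point 4)
    copy = map (vmap (inflate B)) ingredientBlocks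

    copy-occCount-∞ˡ : ∀ y → occCount ∞ y copy ≡ 0
    copy-occCount-∞ˡ y = T.occCount-outsideImage ∞ y ingredientBlocks λ _ _ ()

    copy-occCount-∞ʳ : ∀ x → occCount x ∞ copy ≡ 0
    copy-occCount-∞ʳ x = T.occCount-outsideImage x ∞ ingredientBlocks λ _ _ _ ()

    copy-occCount-∉ : ∀ {p q} a b → p ∉ B ⊎ q ∉ B → occCount (just (p , a)) (just (q , b)) copy ≡ 0
    copy-occCount-∉ a b notBoth = T.occCount-outsideImage _ _ ingredientBlocks (outside notBoth)
      where
      outside : ∀ {p q} → p ∉ B ⊎ q ∉ B →
                ∀ m m' → inflate B m ≡ just (p , a) → inflate B m' ≡ just (q , b) → ⊥
      outside (inj₁ p∉) (j , _) _ eq _ = p∉ (subst (_∈ B) (,-injectiveˡ (just-injective eq)) (∈-lookup j))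
      outside (inj₂ q∉) _ (j , _) _ eq = q∉ (subst (_∈ B) (,-injectiveˡ (just-injective eq)) (∈-lookup j))

    copy-occCount-samePoint : ∀ p a a' → occCount (just (p , a)) (just (p , a')) copy ≡ 0
    copy-occCount-samePoint p a a' with p ∈? B
    ... | no p∉  = copy-occCount-∉ a a' (inj₁ p∉)
    ... | yes p∈ = begin
      occCount (just (p , a)) (just (p , a')) copy
        ≡⟨ cong₂ (λ x y → occCount x y copy) (sym (inflate-index p∈ a)) (sym (inflate-index p∈ a')) ⟩
      occCount (inflate B (index p∈ , a)) (inflate B (index p∈ , a')) copy
        ≡⟨ T.occCount-map _ _ ingredientBlocks ⟩
      DG.occCount (index p∈ , a) (index p∈ , a') ingredientBlocks
        ≡⟨ occCount-sameGroup (All.map proj₂ ingredientShape) refl ⟩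
      0 ∎

    copy-occCount : ∀ {p q} a b → p ≢ q →
      occCount (just (p , a)) (just (q , b)) copy ≡ 2 * (if GDD.memL p B ∧ GDD.memL q B then 1 else 0)
    copy-occCount {p} {q} a b p≢q with p ∈? B | q ∈? B
    ... | no p∉  | _ rewrite GDDProperties.∉⇒memL-false B p∉ = copy-occCount-∉ a b (inj₁ p∉)
    ... | yes p∈ | no q∉ rewrite GDDProperties.∈⇒memL p∈ | GDDProperties.∉⇒memL-false B q∉ =
      copy-occCount-∉ a b (inj₂ q∉)
    ... | yes p∈ | yes q∈ rewrite GDDProperties.∈⇒memL p∈ | GDDProperties.∈⇒memL q∈ = begin
      occCount (just (p , a)) (just (q , b)) copy
        ≡⟨ cong₂ (λ x y → occCount x y copy) (sym (inflate-index p∈ a)) (sym (inflate-index q∈ b)) ⟩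
      occCount (inflate B (index p∈ , a)) (inflate B (index q∈ , b)) copy
        ≡⟨ T.occCount-map _ _ ingredientBlocks ⟩
      DG.occCount (index p∈ , a) (index q∈ , b) ingredientBlocks
        ≡⟨ ingredientTwice _ _ differentGroups ⟩
      2 ∎
      where
      differentGroups : index p∈ ≢ index q∈
      differentGroups same =
        p≢q (trans (lookup-index p∈) (trans (cong (lookup B) same) (sym (lookup-index q∈))))

    copy-simple : AllPairs AtMostTwoCommon copy
    copy-simple = T.superSimple-map ingredientBlocks (proj₂ (proj₂ ingredient))

    copy-blocks : All (DgddBlock B) copy
    copy-blocks = All.map⁺ (All.map (λ {c} → dgddBlock c) ingredientShape)
      where
      dgddBlock : ∀ c → DG.Distinct4 c × GroupTransversal c → DgddBlock B (vmap (inflate B) c)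
      dgddBlock c (distinct , transversal) = record
        { distinct = T.distinct4-map c distinct
        ; spread   = spread
        ; oneCopy  = oneCopy
        }
        where
        spread : ∀ {z} → z ∈ toList (vmap (inflate B) c) →
                 ∃ λ p → ∃ λ a → z ≡ just (p , a) × p ∈ B
        spread z∈ with (j , a) , _ , refl ← ∈-toList-vmap⁻ c z∈ = lookup B j , a , refl , ∈-lookup j

        oneCopy : ∀ {p a a'} → just (p , a) ∈ toList (vmap (inflate B) c) →
                  just (p , a') ∈ toList (vmap (inflate B) c) → a ≡ a'
        oneCopy x∈ x′∈
          with (j , s) , m∈ , eq ← ∈-toList-vmap⁻ c x∈
             | (j′ , s′) , m′∈ , eq′ ← ∈-toList-vmap⁻ c x′∈ =
          trans (,-injectiveʳ (just-injective eq))
            (trans (,-injectiveʳ (groupTransversal-∈ transversal m∈ m′∈ sameGroup))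
                   (sym (,-injectiveʳ (just-injective eq′))))
          where
          sameGroup : j ≡ j′
          sameGroup = Unique⇒lookup-injective (proj₁ good)
            (trans (sym (,-injectiveˡ (just-injective eq))) (,-injectiveˡ (just-injective eq′)))

  InGroup : Group → Point → Set
  InGroup γ ∞              = ⊤
  InGroup γ (just (p , _)) = groupOf p ≡ γ

  record DdBlock (γ : Group) (b : Vec Point 4) : Set where
    field
      distinct : Distinct4 b
      within   : ∀ {z} → z ∈ toList b → InGroup γ z

  liftInto : (γ : Group) → Maybe (Fin (g (proj₁ γ)) × Fin α) → Point
  liftInto (i , t) nothing        = ∞
  liftInto (i , t) (just (s , a)) = just ((i , t , s) , a)

  liftInto-injective : ∀ γ → Injective _≡_ _≡_ (liftInto γ)
  liftInto-injective γ {nothing}      {nothing}       _    = refl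
  liftInto-injective γ {just (s , a)} {just (s , a)} refl = refl

  liftInto-InGroup : ∀ γ w → InGroup γ (liftInto γ w)
  liftInto-InGroup γ nothing  = tt
  liftInto-InGroup γ (just _) = refl

  liftInto-onto : ∀ γ {z} → InGroup γ z → ∃ λ w → liftInto γ w ≡ z
  liftInto-onto γ {∞}                        _    = nothing , refl
  liftInto-onto γ {just ((_ , _ , s) , a)} refl = just (s , a) , refl

  module OverGroup (γ : Group) where
    private
      θ : Fin (α * g (proj₁ γ) + 1) ↔ Maybe (Fin (g (proj₁ γ)) × Fin α)
      θ = inflated↔ α (g (proj₁ γ)) ↔-refl
      open Inverse θ

      embed : Fin (α * g (proj₁ γ) + 1) → Point
      embed = liftInto γ ∘ to

      embed-InGroup : ∀ m → InGroup γ (embed m)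
      embed-InGroup = liftInto-InGroup γ ∘ to

      embed-onto : ∀ {z} → InGroup γ z → ∃ λ m → embed m ≡ z
      embed-onto z∈γ with w , eq ← liftInto-onto γ z∈γ =
        from w , trans (cong (liftInto γ) (strictlyInverseˡ w)) eq

      module T = Transport _≟F_ _≟_ embed (Injection.injective (↔⇒↣ θ) ∘ liftInto-injective γ)
      module DD = DDv (α * g (proj₁ γ) + 1)
      ingredient = dd (proj₁ γ)

      ingredientBlocks : List (Vec (Fin (α * g (proj₁ γ) + 1)) 4)
      ingredientBlocks = proj₁ ingredient

      ingredientTwice : ∀ x y → x ≢ y → DD.occCount x y ingredientBlocks ≡ 2
      ingredientTwice = proj₂ (proj₁ (proj₂ ingredient))

    copy : List (Vec Point 4)
    copy = map (vmap embed) ingredientBlocks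

    copy-occCount-inside : ∀ {x y} → InGroup γ x → InGroup γ y → x ≢ y → occCount x y copy ≡ 2
    copy-occCount-inside x∈γ y∈γ x≢y with m , refl ← embed-onto x∈γ | m′ , refl ← embed-onto y∈γ =
      trans (T.occCount-map m m′ ingredientBlocks) (ingredientTwice m m′ (x≢y ∘ cong embed))

    copy-occCount-outside : ∀ {x y} → ¬ (InGroup γ x × InGroup γ y) → occCount x y copy ≡ 0
    copy-occCount-outside notBoth = T.occCount-outsideImage _ _ ingredientBlocks
      λ { m m′ refl refl → notBoth (embed-InGroup m , embed-InGroup m′) }

    copy-simple : AllPairs AtMostTwoCommon copy
    copy-simple = T.superSimple-map ingredientBlocks (proj₂ (proj₂ ingredient))

    copy-blocks : All (DdBlock γ) copy
    copy-blocks = All.map⁺ (All.map (λ {c} → ddBlock c) (proj₁ (proj₁ (proj₂ ingredient))))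
      where
      ddBlock : ∀ c → DD.Distinct4 c → DdBlock γ (vmap embed c)
      ddBlock c distinct = record { distinct = T.distinct4-map c distinct ; within = within }
        where
        within : ∀ {z} → z ∈ toList (vmap embed c) → InGroup γ z
        within z∈ with m , _ , refl ← ∈-toList-vmap⁻ c z∈ = embed-InGroup m

  dgddPart : (Bs : List (List P)) → All GoodBlock Bs → List (Vec Point 4)
  dgddPart []       []             = []
  dgddPart (B ∷ Bs) (good ∷ goods) = OverBlock.copy B good ++ dgddPart Bs goods

  dgddPart-occCount≡0 : ∀ {x y} Bs goods → (∀ B good → occCount x y (OverBlock.copy B good) ≡ 0) →
                        occCount x y (dgddPart Bs goods) ≡ 0
  dgddPart-occCount≡0 []       []             _    = refl
  dgddPart-occCount≡0 {x} {y} (B ∷ Bs) (good ∷ goods) none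
    rewrite count-++ (occursOrd x y) (OverBlock.copy B good) (dgddPart Bs goods) | none B good =
    dgddPart-occCount≡0 Bs goods none

  dgddPart-occCount : ∀ {p q} a b → p ≢ q → ∀ Bs goods →
    occCount (just (p , a)) (just (q , b)) (dgddPart Bs goods) ≡ 2 * GDD.pairCount p q Bs
  dgddPart-occCount a b p≢q []       []             = refl
  dgddPart-occCount {p} {q} a b p≢q (B ∷ Bs) (good ∷ goods) = begin
    occCount x y (OverBlock.copy B good ++ dgddPart Bs goods)
      ≡⟨ count-++ (occursOrd x y) (OverBlock.copy B good) (dgddPart Bs goods) ⟩
    occCount x y (OverBlock.copy B good) + occCount x y (dgddPart Bs goods)
      ≡⟨ cong₂ _+_ (OverBlock.copy-occCount B good a b p≢q) (dgddPart-occCount a b p≢q Bs goods) ⟩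
    2 * (if GDD.memL p B ∧ GDD.memL q B then 1 else 0) + 2 * GDD.pairCount p q Bs
      ≡⟨ sym (*-distribˡ-+ 2 (if GDD.memL p B ∧ GDD.memL q B then 1 else 0) (GDD.pairCount p q Bs)) ⟩
    2 * GDD.pairCount p q (B ∷ Bs) ∎
    where
    open ≡-Reasoning
    x y : Point
    x = just (p , a)
    y = just (q , b)

  groupCopies : Fin n → List (Vec Point 4)
  groupCopies i = concat (tabulate λ t → OverGroup.copy (i , t))

  ddPart : List (Vec Point 4)
  ddPart = concat (tabulate groupCopies)

  ddPart-occCount : ∀ x y →
    occCount x y ddPart ≡ sum (tabulate λ i → sum (tabulate λ t → occCount x y (OverGroup.copy (i , t))))
  ddPart-occCount x y = trans (count-concat-tabulate (occursOrd x y) groupCopies)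
    (cong sum (tabulate-cong λ i → count-concat-tabulate (occursOrd x y) (λ t → OverGroup.copy (i , t))))

  ,-injectiveʳ-Group : ∀ {i} {t t′ : Fin (u i)} → (Group ∋ (i , t)) ≡ (i , t′) → t ≡ t′
  ,-injectiveʳ-Group refl = refl

  InGroup-unique : ∀ {γ γ′ x y} → x ≢ y →
                   InGroup γ x → InGroup γ y → InGroup γ′ x → InGroup γ′ y → γ ≡ γ′
  InGroup-unique {x = ∞}      {∞}      x≢y _   _   _    _    = ⊥-elim (x≢y refl)
  InGroup-unique {x = ∞}      {just _} _   _   y∈γ _    y∈γ′ = trans (sym y∈γ) y∈γ′
  InGroup-unique {x = just _}          _   x∈γ _   x∈γ′ _    = trans (sym x∈γ) x∈γ′

  ddPart-occCount-withinGroup : ∀ {γ x y} → InGroup γ x → InGroup γ y → x ≢ y → occCount x y ddPart ≡ 2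
  ddPart-occCount-withinGroup {i , t} {x} {y} x∈γ y∈γ x≢y =
    trans (ddPart-occCount x y)
      (trans (sum-tabulate-single n _ i λ i′ i′≢i →
                sum-tabulate-≡0 (u i′) _ λ t′ → outside (i′≢i ∘ cong proj₁))
        (trans (sum-tabulate-single (u i) _ t λ t′ t′≢t → outside (t′≢t ∘ ,-injectiveʳ-Group))
               (OverGroup.copy-occCount-inside (i , t) x∈γ y∈γ x≢y)))
    where
    outside : ∀ {γ′} → γ′ ≢ (i , t) → occCount x y (OverGroup.copy γ′) ≡ 0
    outside γ′≢γ = OverGroup.copy-occCount-outside _
      λ (x∈γ′ , y∈γ′) → γ′≢γ (InGroup-unique x≢y x∈γ′ y∈γ′ x∈γ y∈γ)

  ddPart-occCount-outside : ∀ {x y} → (∀ γ → ¬ (InGroup γ x × InGroup γ y)) → occCount x y ddPart ≡ 0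
  ddPart-occCount-outside {x} {y} outside =
    trans (ddPart-occCount x y)
      (sum-tabulate-≡0 n _ λ i → sum-tabulate-≡0 (u i) _ λ t →
         OverGroup.copy-occCount-outside (i , t) (outside (i , t)))

  design : List (Vec Point 4)
  design = dgddPart gddBlocks goodBlocks ++ ddPart

  data PairKind : Point → Point → Set where
    withinGroup  : ∀ γ {x y} → InGroup γ x → InGroup γ y → PairKind x y
    acrossGroups : ∀ {p q} a b → groupOf p ≢ groupOf q → PairKind (just (p , a)) (just (q , b))

  pairKind : ∀ {x y} → x ≢ y → PairKind x y
  pairKind {∞}            {∞}            x≢y = ⊥-elim (x≢y refl)
  pairKind {∞}            {just (q , _)} _   = withinGroup (groupOf q) tt refl
  pairKind {just (p , _)} {∞}            _   = withinGroup (groupOf p) refl tt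
  pairKind {just (p , a)} {just (q , b)} _   with groupOf p ≟G groupOf q
  ... | yes same = withinGroup (groupOf p) refl (sym same)
  ... | no other = acrossGroups a b other

  dgddPart-occCount-withinGroup : ∀ {γ x y} → InGroup γ x → InGroup γ y → x ≢ y →
                                occCount x y (dgddPart gddBlocks goodBlocks) ≡ 0
  dgddPart-occCount-withinGroup {x = ∞} _ _ _ =
    dgddPart-occCount≡0 gddBlocks goodBlocks λ B good → OverBlock.copy-occCount-∞ˡ B good _
  dgddPart-occCount-withinGroup {x = just _} {∞} _ _ _ =
    dgddPart-occCount≡0 gddBlocks goodBlocks λ B good → OverBlock.copy-occCount-∞ʳ B good _
  dgddPart-occCount-withinGroup {x = just (p , a)} {just (q , b)} p∈γ q∈γ _ with p ≟P q
  ... | yes refl =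
    dgddPart-occCount≡0 gddBlocks goodBlocks λ B good → OverBlock.copy-occCount-samePoint B good p a b
  ... | no p≢q = trans (dgddPart-occCount a b p≢q gddBlocks goodBlocks)
                       (cong (2 *_) (pairCount-sameGroup p≢q (trans p∈γ (sym q∈γ))))

  design-occCount : ∀ x y → x ≢ y → occCount x y design ≡ 2
  design-occCount x y x≢y =
    trans (count-++ (occursOrd x y) (dgddPart gddBlocks goodBlocks) ddPart) (byKind x≢y (pairKind x≢y))
    where
    byKind : ∀ {x y} → x ≢ y → PairKind x y →
             occCount x y (dgddPart gddBlocks goodBlocks) + occCount x y ddPart ≡ 2
    byKind x≢y (withinGroup γ x∈γ y∈γ) =
      cong₂ _+_ (dgddPart-occCount-withinGroup x∈γ y∈γ x≢y) (ddPart-occCount-withinGroup x∈γ y∈γ x≢y)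
    byKind _ (acrossGroups a b other) =
      cong₂ _+_ (trans (dgddPart-occCount a b (other ∘ cong groupOf) gddBlocks goodBlocks)
                       (cong (2 *_) (pairCount-otherGroup other)))
                (ddPart-occCount-outside λ γ (p∈γ , q∈γ) → other (trans p∈γ (sym q∈γ)))

  sameCopy : ∀ {B b p q a c} → DgddBlock B b → just (p , a) ∈ toList b → just (q , c) ∈ toList b →
             p ≡ q → just (p , a) ≡ just (q , c)
  sameCopy d x∈ y∈ refl = cong (λ a → just (_ , a)) (DgddBlock.oneCopy d x∈ y∈)

  dgddBlocks-meet : ∀ {B B′ b b′} → MeetAtMostOnce B B′ → DgddBlock B b → DgddBlock B′ b′ →
                    MeetAtMostOnce (toList b) (toList b′)
  dgddBlocks-meet {B′ = B′} meet d d′ x∈b x∈b′ y∈b y∈b′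
    with p , a , refl , p∈B ← DgddBlock.spread d x∈b | q , c , refl , q∈B ← DgddBlock.spread d y∈b =
    sameCopy d x∈b y∈b (meet p∈B (alsoIn x∈b′) q∈B (alsoIn y∈b′))
    where
    alsoIn : ∀ {r e} → just (r , e) ∈ toList _ → r ∈ B′
    alsoIn z∈ with _ , _ , eq , r∈ ← DgddBlock.spread d′ z∈ =
      subst (_∈ B′) (sym (,-injectiveˡ (just-injective eq))) r∈

  dgddBlock-ddBlock-meet : ∀ {B γ b b′} → Transversal B → DgddBlock B b → DdBlock γ b′ →
                           MeetAtMostOnce (toList b) (toList b′)
  dgddBlock-ddBlock-meet transversal d d′ x∈b x∈b′ y∈b y∈b′
    with p , a , refl , p∈B ← DgddBlock.spread d x∈b | q , c , refl , q∈B ← DgddBlock.spread d y∈b =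
    sameCopy d x∈b y∈b
      (transversal p∈B q∈B (trans (DdBlock.within d′ x∈b′) (sym (DdBlock.within d′ y∈b′))))

  ddBlocks-meet : ∀ {γ γ′ b b′} → γ ≢ γ′ → DdBlock γ b → DdBlock γ′ b′ →
                  MeetAtMostOnce (toList b) (toList b′)
  ddBlocks-meet _    _ _  {∞}      {∞}      _   _    _   _    = refl
  ddBlocks-meet γ≢γ′ d d′ {just _}          x∈b x∈b′ _   _    =
    ⊥-elim (γ≢γ′ (trans (sym (DdBlock.within d x∈b)) (DdBlock.within d′ x∈b′)))
  ddBlocks-meet γ≢γ′ d d′ {∞}      {just _} _   _    y∈b y∈b′ =
    ⊥-elim (γ≢γ′ (trans (sym (DdBlock.within d y∈b)) (DdBlock.within d′ y∈b′)))

  dgddPart-blocks : ∀ Bs goods → All (λ b → ∃ λ B → B ∈ Bs × DgddBlock B b) (dgddPart Bs goods)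
  dgddPart-blocks []       []             = []
  dgddPart-blocks (B ∷ Bs) (good ∷ goods) =
    All.++⁺ (All.map (λ d → B , here refl , d) (OverBlock.copy-blocks B good))
            (All.map (λ (B′ , B′∈ , d) → B′ , there B′∈ , d) (dgddPart-blocks Bs goods))

  dgddPart-simple : ∀ Bs goods → AllPairs MeetAtMostOnce Bs → AllPairs AtMostTwoCommon (dgddPart Bs goods)
  dgddPart-simple []       []             []               = []
  dgddPart-simple (B ∷ Bs) (good ∷ goods) (meets ∷ meetss) =
    AllPairs.++⁺ (OverBlock.copy-simple B good) (dgddPart-simple Bs goods meetss)
      (All.map (λ d → All.map (λ (B′ , B′∈ , d′) →
          meetAtMostOnce⇒atMostTwoCommon (DgddBlock.distinct d) (DgddBlock.distinct d′)
            (dgddBlocks-meet (All.lookup meets B′∈) d d′))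
        (dgddPart-blocks Bs goods)) (OverBlock.copy-blocks B good))

  groupCopies-blocks : ∀ i → All (λ b → ∃ λ t → DdBlock (i , t) b) (groupCopies i)
  groupCopies-blocks i = All.concat⁺ (All.tabulate⁺ λ t → All.map (t ,_) (OverGroup.copy-blocks (i , t)))

  ddPart-blocks : All (λ b → ∃ λ γ → DdBlock γ b) ddPart
  ddPart-blocks = All.concat⁺ (All.tabulate⁺ λ i → All.map (λ (t , d) → (i , t) , d) (groupCopies-blocks i))

  ddBlocks-atMostTwoCommon : ∀ {γ γ′ b b′} → γ ≢ γ′ →
                             DdBlock γ b → DdBlock γ′ b′ → AtMostTwoCommon b b′
  ddBlocks-atMostTwoCommon γ≢γ′ d d′ =
    meetAtMostOnce⇒atMostTwoCommon (DdBlock.distinct d) (DdBlock.distinct d′) (ddBlocks-meet γ≢γ′ d d′)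

  groupCopies-simple : ∀ i → AllPairs AtMostTwoCommon (groupCopies i)
  groupCopies-simple i = AllPairs.concat⁺ (All.tabulate⁺ λ t → OverGroup.copy-simple (i , t))
    (AllPairs.tabulate⁺ λ {t} {t′} t≢t′ →
      All.map (λ d → All.map (ddBlocks-atMostTwoCommon (t≢t′ ∘ ,-injectiveʳ-Group) d)
                             (OverGroup.copy-blocks (i , t′)))
        (OverGroup.copy-blocks (i , t)))

  ddPart-simple : AllPairs AtMostTwoCommon ddPart
  ddPart-simple = AllPairs.concat⁺ (All.tabulate⁺ groupCopies-simple)
    (AllPairs.tabulate⁺ λ {i} {i′} i≢i′ →
      All.map (λ (_ , d) → All.map (λ (_ , d′) → ddBlocks-atMostTwoCommon (i≢i′ ∘ cong proj₁) d d′)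
                                   (groupCopies-blocks i′))
        (groupCopies-blocks i))

  design-simple : AllPairs AtMostTwoCommon design
  design-simple =
    AllPairs.++⁺ (dgddPart-simple gddBlocks goodBlocks blocks-meetAtMostOnce) ddPart-simple
      (All.map (λ (_ , B∈ , d) → All.map (λ (_ , d′) →
          meetAtMostOnce⇒atMostTwoCommon (DgddBlock.distinct d) (DdBlock.distinct d′)
            (dgddBlock-ddBlock-meet (All.lookup blocks-transversal B∈) d d′)) ddPart-blocks)
        (dgddPart-blocks gddBlocks goodBlocks))

  design-distinct : All Distinct4 design
  design-distinct =
    All.++⁺ (All.map (DgddBlock.distinct ∘ proj₂ ∘ proj₂) (dgddPart-blocks gddBlocks goodBlocks))
            (All.map (DdBlock.distinct ∘ proj₂) ddPart-blocks)

mainTheorem3 : (K : ℕ → Set) → (∀ k → K k → 1 ≤ k) →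
    (α : ℕ) → 1 ≤ α →
    (n : ℕ) (g u : Fin n → ℕ) →
    GDD K n g u →
    (∀ i → SuperSimpleDD (α * g i + 1)) →
    (∀ k → K k → SuperSimpleDGDD α k) →
    SuperSimpleDD (α * sumGU n g u + 1)
mainTheorem3 K _ α _ n g u (gddBlocks , isGDD) dd dgdd =
  superSimpleDD-↔ _≟_ (inflated↔ α (sumGU n g u) (Fin-sumGU↔GPoint n g u)) design
    (design-distinct , design-occCount , design-simple)
  where open Construction K α n g u gddBlocks isGDD dd dgdd
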